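{- Let $\mathcal T$ be a basic theory and $\zeta\Rightarrow_r\eta$ a graded implication. If there is a forest proof of $\zeta\Rightarrow_r\eta$ from $\mathcal T$, then there is a forest proof of $\zeta\Rightarrow_r\eta$ from $\mathcal T$ such that (i) every node labelled $\divideontimes$ is terminal, and (ii) no node labelled $\divideontimes$ has siblings.
   Context: Boolean formulas are built from countably many variables and $\bot,\top$ via $\wedge,\vee,\neg$; $\alpha,\beta$ are Boolean equivalent if $\alpha\to\beta$ and $\beta\to\alpha$ are classical tautologies. A graded implication is $\alpha\Rightarrow_d\beta$, $d\in\mathbb R^+=[0,\infty)$. A literal is $\phi$ or $\neg\phi$ for a variable $\phi$; a clause is a finite set of literals, inconsistent if it contains some $\phi$ and $\neg\phi$, consistent otherwise; a clause set is a finite set of clauses. For a clause set $B$, $f(B)=\bigvee_{L\in B}\bigwedge L$ (empty conjunction $=\top$, empty disjunction $=\bot$); $B$ is a clause set for $\alpha$ if $f(B)$ is Boolean equivalent to $\alpha$. A basic implication is $\lambda_1\wedge\dots\wedge\lambda_n\Rightarrow_d\bigvee_{i=1}^l\bigwedge_{j=1}^{k_i}\mu_{ij}$ with $n\ge1$, $l\ge0$, $k_i\ge1$, where $\{\lambda_1,\dots,\lambda_n\}$ and all $\{\mu_{i1},\dots,\mu_{ik_i}\}$ are consistent clauses; a basic theory is a set of basic implications. A proof forest is a finite directed forest (each component a rooted tree, edges directed from father to child) with a weight in $\mathbb R^+$ on each edge, each node being labelled by a clause or by the symbol $\divideontimes$ (nodes are identified with their labels; nodes not labelled $\divideontimes$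 are proper). A branch is a maximal root-to-leaf path; its length is $0$ if it contains $\divideontimes$ and otherwise the sum of its edge weights; the length of the forest is the maximum length of its branches. A forest proof of $\zeta\Rightarrow_r\eta$ from a basic theory $\mathcal T$ is a proof forest such that: (T1) there is a clause set $B_\zeta$ for $\zeta$ such that each clause of $B_\zeta$ has a root that is a subset of it; (T2) there is a clause set $B_\eta$ for $\eta$ such that every terminal clause includes some clause of $B_\eta$; (T3) the length of the forest is at most $r$; (T4) for every non-terminal clause $L$, all edges from $L$ have the same weight $c$, and one of the following holds: (A) $c=0$ and $\mathcal T$ contains a basic implication $\lambda_1\wedge\dots\wedge\lambda_n\Rightarrow_0\bigvee_{i=1}^l\bigwedge_j\mu_{ij}$ with $\{\lambda_1,\dots,\lambda_n\}\subseteq L$ such that for each $i=1,\dots,l$ some child of $L$ is a clause $L'\subseteq\{\mu_{i1},\dots,\mu_{ik_i}\}\cup L$; (B) $c>0$ and $\mathcal T$ contains a basic implication $\lambda_1\wedge\dots\wedge\lambda_n\Rightarrow_c\bigvee_{i=1}^l\bigwedge_j\mu_{ij}$ with $\{\lambda_1,\dots,\lambda_n\}\subseteq L$ such that for each $i$ some child of $L$ is a clause $L'\subseteq\{\mu_{i1},\dots,\mu_{ik_i}\}$; (C) $c=0$, $L$ is inconsistent and $\divideontimes$ is the only child of $L$; (D) $c=0$ and for some variable $\phi$ (the splitting variable), $L$ has exactly two children, one consisting of $\phi$ together with a subset of $L$, the other consisting of $\neg\phi$ together with a subset of $L$. -}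

module Defs where

open import Data.Nat using (ℕ)
open import Data.Bool using (Bool; true; false; _∧_; _∨_; not)
open import Data.List using (List; []; _∷_; _++_; map; foldr)
open import Data.List.Membership.Propositional using (_∈_)
open import Data.Product using (Σ; ∃; ∃-syntax; _×_; _,_; proj₁; proj₂)
open import Data.Sum using (_⊎_)
open import Data.Empty using (⊥)
open import Relation.Nullary using (¬_)
open import Relation.Binary.PropositionalEquality using (_≡_)

data Formula : Set where
  var  : ℕ → Formula
  ⊥f ⊤f : Formula
  _∧f_ _∨f_ : Formula → Formula → Formula
  ¬f_  : Formula → Formula

Valuation : Set
Valuation = ℕ → Bool

eval : Valuation → Formula → Bool
eval v (var n)   = v n
eval v ⊥f        = false
eval v ⊤f        = true
eval v (a ∧f b)  = eval v a ∧ eval v b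
eval v (a ∨f b)  = eval v a ∨ eval v b
eval v (¬f a)    = not (eval v a)

_⇒f_ : Formula → Formula → Formula
a ⇒f b = (¬f a) ∨f b

Tautology : Formula → Set
Tautology a = ∀ (v : Valuation) → eval v a ≡ true

BoolEquiv : Formula → Formula → Set
BoolEquiv a b = Tautology (a ⇒f b) × Tautology (b ⇒f a)

-- Literals, clauses, clause sets (finite sets represented by lists,
-- compared via membership)

data Literal : Set where
  pos : ℕ → Literal
  neg : ℕ → Literal

Clause : Set
Clause = List Literal

ClauseSet : Set
ClauseSet = List Clause

_⊆_ : Clause → Clause → Set
K ⊆ L = ∀ {x} → x ∈ K → x ∈ L

Inconsistent : Clause → Set
Inconsistent L = ∃[ φ ] (pos φ ∈ L × neg φ ∈ L)

Consistent : Clause → Set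
Consistent L = ¬ Inconsistent L

NonEmpty : Clause → Set
NonEmpty L = ∃[ x ] (x ∈ L)

litF : Literal → Formula
litF (pos n) = var n
litF (neg n) = ¬f (var n)

conjF : Clause → Formula
conjF L = foldr _∧f_ ⊤f (map litF L)

fB : ClauseSet → Formula
fB B = foldr _∨f_ ⊥f (map conjF B)

ClauseSetFor : ClauseSet → Formula → Set
ClauseSetFor B α = BoolEquiv (fB B) α

-- Abstract weight domain standing in for ℝ⁺ = [0,∞)
-- (the standard library has no real numbers)

record Weights : Set₁ where
  field
    Carrier : Set
    0#      : Carrier
    _+_     : Carrier → Carrier → Carrier
    _≤_     : Carrier → Carrier → Set
    _<_     : Carrier → Carrier → Set

module _ (W : Weights) where
  open Weights W

  -- Basic implications  λ₁ ∧ … ∧ λₙ ⇒_d ⋁_i ⋀_j μ_ij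

  record BasicImp : Set where
    field
      premise     : Clause
      premise-ne  : NonEmpty premise
      premise-con : Consistent premise
      grade       : Carrier
      conclusion  : List Clause       -- the clauses {μ_i1,…,μ_ik_i}, i = 1..l (l ≥ 0)
      concl-ne    : ∀ {M} → M ∈ conclusion → NonEmpty M
      concl-con   : ∀ {M} → M ∈ conclusion → Consistent M

  BasicTheory : Set₁
  BasicTheory = BasicImp → Set

  data Label : Set where
    ⋇  : Label
    cl : Clause → Label

  data Tree : Set where
    node : Label → List (Carrier × Tree) → Tree

  Forest : Set
  Forest = List Tree

  label : Tree → Label
  label (node l _) = l

  children : Tree → List (Carrier × Tree)
  children (node _ cs) = cs

  data SubTree (s : Tree) : Tree → Set where
    here  : SubTree s s
    there : ∀ {l cs w t} → (w , t) ∈ cs → SubTree s t → SubTree s (node l cs)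

  NodeOf : Tree → Forest → Set
  NodeOf s F = ∃[ t ] (t ∈ F × SubTree s t)

  data Branch : Tree → Set where
    leaf : ∀ {l} → Branch (node l [])
    step : ∀ {l cs w t} → (w , t) ∈ cs → Branch t → Branch (node l cs)

  containsStar : ∀ {t} → Branch t → Set
  containsStar {node ⋇ _}      _          = Data.Unit.⊤
    where import Data.Unit
  containsStar {node (cl _) _} leaf       = ⊥
  containsStar {node (cl _) _} (step _ b) = containsStar b

  weightSum : ∀ {t} → Branch t → Carrier
  weightSum leaf               = 0#
  weightSum (step {w = w} _ b) = w + weightSum b

  data BranchLength {t : Tree} (b : Branch t) : Carrier → Set where
    starred : containsStar b → BranchLength b 0#
    proper  : ¬ containsStar b → BranchLength b (weightSum b)

  LengthAtMost : Forest → Carrier → Set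
  LengthAtMost F r =
    ∀ {t} → t ∈ F → (b : Branch t) → ∀ {x} → BranchLength b x → x ≤ r

  ChildClause : List (Carrier × Tree) → Clause → Set
  ChildClause cs L' = ∃[ w ] ∃[ ds ] ((w , node (cl L') ds) ∈ cs)

  AllWeights : List (Carrier × Tree) → Carrier → Set
  AllWeights cs c = ∀ {w t} → (w , t) ∈ cs → w ≡ c

  RuleA : BasicTheory → Clause → List (Carrier × Tree) → Carrier → Set
  RuleA T L cs c = c ≡ 0# × Σ BasicImp λ bi →
    T bi × BasicImp.grade bi ≡ 0# × BasicImp.premise bi ⊆ L ×
    (∀ {M} → M ∈ BasicImp.conclusion bi →
       ∃[ L' ] (ChildClause cs L' × L' ⊆ (M ++ L)))

  RuleB : BasicTheory → Clause → List (Carrier × Tree) → Carrier → Set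
  RuleB T L cs c = 0# < c × Σ BasicImp λ bi →
    T bi × BasicImp.grade bi ≡ c × BasicImp.premise bi ⊆ L ×
    (∀ {M} → M ∈ BasicImp.conclusion bi →
       ∃[ L' ] (ChildClause cs L' × L' ⊆ M))

  RuleC : Clause → List (Carrier × Tree) → Carrier → Set
  RuleC L cs c = c ≡ 0# × Inconsistent L ×
    ∃[ w ] ∃[ ds ] (cs ≡ (w , node ⋇ ds) ∷ [])

  SplitChild : Literal → Clause → Clause → Set
  SplitChild x L L' = x ∈ L' × L' ⊆ (x ∷ L)

  RuleD : Clause → List (Carrier × Tree) → Carrier → Set
  RuleD L cs c = c ≡ 0# × ∃[ φ ] ∃[ w₁ ] ∃[ L₁ ] ∃[ ds₁ ] ∃[ w₂ ] ∃[ L₂ ] ∃[ ds₂ ]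
    (cs ≡ (w₁ , node (cl L₁) ds₁) ∷ (w₂ , node (cl L₂) ds₂) ∷ [] ×
     ((SplitChild (pos φ) L L₁ × SplitChild (neg φ) L L₂) ⊎
      (SplitChild (neg φ) L L₁ × SplitChild (pos φ) L L₂)))

  T4Node : BasicTheory → Tree → Set
  T4Node T (node ⋇ cs)      = Data.Unit.⊤
    where import Data.Unit
  T4Node T (node (cl L) [])  = Data.Unit.⊤
    where import Data.Unit
  T4Node T (node (cl L) cs@(_ ∷ _)) = ∃[ c ] (AllWeights cs c ×
    (RuleA T L cs c ⊎ RuleB T L cs c ⊎ RuleC L cs c ⊎ RuleD L cs c))

  record ForestProof (T : BasicTheory) (ζ : Formula) (r : Carrier) (η : Formula)
                     (F : Forest) : Set where
    field
      T1 : ∃[ B ] (ClauseSetFor B ζ ×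
             (∀ {K} → K ∈ B → ∃[ t ] ∃[ L ] (t ∈ F × label t ≡ cl L × L ⊆ K)))
      T2 : ∃[ B ] (ClauseSetFor B η ×
             (∀ {L} → NodeOf (node (cl L) []) F → ∃[ K ] (K ∈ B × K ⊆ L)))
      T3 : LengthAtMost F r
      T4 : ∀ {s} → NodeOf s F → T4Node T s

  StarsTerminal : Forest → Set
  StarsTerminal F = ∀ {cs} → NodeOf (node ⋇ cs) F → cs ≡ []

  StarsNoSiblings : Forest → Set
  StarsNoSiblings F = ∀ {l cs w ds} → NodeOf (node l cs) F →
    (w , node ⋇ ds) ∈ cs → ∃[ w' ] ∃[ t' ] (cs ≡ (w' , t') ∷ [])

module Submission where

-- A forest proof is put into normal form by *pruning* every
-- tree: a ⋇-node loses all of its descendants, and a clause node keeps only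
-- its (pruned) clause children, except when it has no clause children at
-- all, in which case it keeps just its first child (necessarily a ⋇-leaf).
--
-- Hence pruning
-- preserves (T1)-(T4), while properties (i) and (ii) hold for every pruned
-- forest.  Lemma 3.6 is then the combination of these facts.

open import Defs
open import Data.Product using (Σ; ∃-syntax; _×_; _,_; proj₁; proj₂)
open import Data.List using (List; []; _∷_; map; filter; take)
open import Data.List.Membership.Propositional using (_∈_)
open import Data.List.Membership.Propositional.Properties using (∈-map⁺; ∈-map⁻; ∈-filter⁺; ∈-filter⁻)
open import Data.List.Relation.Unary.Any using (here; there)
open import Data.Sum using (_⊎_; inj₁; inj₂) renaming (map to ⊎-map)
open import Data.Empty using (⊥; ⊥-elim)
open import Data.Unit using (⊤; tt)
open import Relation.Nullary using (¬_; yes; no; contradiction)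
open import Relation.Unary using (Decidable)
open import Relation.Binary.PropositionalEquality using (_≡_; _≢_; refl; cong; subst; sym; trans)

module FilterOrFirst {a p} {A : Set a} {P : A → Set p} (P? : Decidable P) where

  _orElse_ : List A → List A → List A
  [] orElse ys = ys
  (x ∷ xs) orElse _ = x ∷ xs

  ∈-orElse⁺ : ∀ {x} {xs : List A} ys → x ∈ xs → x ∈ xs orElse ys
  ∈-orElse⁺ ys (here e) = here e
  ∈-orElse⁺ ys (there m) = there m

  ∈-orElse⁻ : ∀ (xs : List A) {ys x} → x ∈ xs orElse ys → x ∈ xs ⊎ (xs ≡ [] × x ∈ ys)
  ∈-orElse⁻ [] m = inj₂ (refl , m)
  ∈-orElse⁻ (_ ∷ _) m = inj₁ m

  orElse-≢[] : ∀ (xs : List A) {ys} → ys ≢ [] → xs orElse ys ≢ []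
  orElse-≢[] [] ys≢[] = ys≢[]
  orElse-≢[] (_ ∷ _) _ ()

  ∈-take1 : ∀ (xs : List A) {x} → x ∈ take 1 xs → x ∈ xs × take 1 xs ≡ x ∷ []
  ∈-take1 (_ ∷ _) (here refl) = here refl , refl
  ∈-take1 (_ ∷ _) (there ())

  select : List A → List A
  select xs = filter P? xs orElse take 1 xs

  select-⊆ : ∀ (xs : List A) {x} → x ∈ select xs → x ∈ xs
  select-⊆ xs m with ∈-orElse⁻ (filter P? xs) m
  ... | inj₁ m′ = proj₁ (∈-filter⁻ P? {xs = xs} m′)
  ... | inj₂ (_ , m′) = proj₁ (∈-take1 xs m′)

  select-⊇ : ∀ {xs : List A} {x} → x ∈ xs → P x → x ∈ select xs
  select-⊇ {xs} m px = ∈-orElse⁺ (take 1 xs) (∈-filter⁺ P? m px)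

  select-≢[] : ∀ x (xs : List A) → select (x ∷ xs) ≢ []
  select-≢[] x xs = orElse-≢[] (filter P? (x ∷ xs)) λ ()

  select-rejected : ∀ (xs : List A) {x} → ¬ P x → x ∈ select xs → select xs ≡ x ∷ []
  select-rejected xs ¬px m with ∈-orElse⁻ (filter P? xs) m
  ... | inj₁ m′ = contradiction (proj₂ (∈-filter⁻ P? {xs = xs} m′)) ¬px
  ... | inj₂ (none , m′) =
    trans (cong (_orElse take 1 xs) none) (proj₂ (∈-take1 xs m′))

module Pruning (W : Weights) where
  open Weights W

  Edge : Set
  Edge = Carrier × Tree W

  ProperEdge : Edge → Set
  ProperEdge (_ , node ⋇ _) = ⊥
  ProperEdge (_ , node (cl _) _) = ⊤

  proper? : Decidable ProperEdge
  proper? (_ , node ⋇ _) = no λ ()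
  proper? (_ , node (cl _) _) = yes tt

  open FilterOrFirst proper?

  mutual
    prune : Tree W → Tree W
    prune (node ⋇ _) = node ⋇ []
    prune (node (cl L) es) = node (cl L) (prunedChildren es)

    prunedChildren : List Edge → List Edge
    prunedChildren es = select (pruneEdges es)

    pruneEdges : List Edge → List Edge
    pruneEdges [] = []
    pruneEdges ((w , t) ∷ es) = (w , prune t) ∷ pruneEdges es

  pruneForest : Forest W → Forest W
  pruneForest = map prune

  pruneEdges-∈⁻ : ∀ es {w t′} → (w , t′) ∈ pruneEdges es → ∃[ t ] ((w , t) ∈ es × t′ ≡ prune t)
  pruneEdges-∈⁻ ((_ , t) ∷ _) (here refl) = t , here refl , refl
  pruneEdges-∈⁻ (_ ∷ es) (there m) with pruneEdges-∈⁻ es m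
  ... | t , m′ , e = t , there m′ , e

  pruneEdges-∈⁺ : ∀ {es w t} → (w , t) ∈ es → (w , prune t) ∈ pruneEdges es
  pruneEdges-∈⁺ {_ ∷ _} (here refl) = here refl
  pruneEdges-∈⁺ {_ ∷ _} (there m) = there (pruneEdges-∈⁺ m)

  prunedChild-origin : ∀ es {w t′} → (w , t′) ∈ prunedChildren es → ∃[ t ] ((w , t) ∈ es × t′ ≡ prune t)
  prunedChild-origin es m = pruneEdges-∈⁻ es (select-⊆ (pruneEdges es) m)

  prunedChild-clause : ∀ es {w L ds} → (w , node (cl L) ds) ∈ es →
    (w , node (cl L) (prunedChildren ds)) ∈ prunedChildren es
  prunedChild-clause es m = select-⊇ (pruneEdges-∈⁺ m) tt

  prunedChildren-≢[] : ∀ e es → prunedChildren (e ∷ es) ≢ []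
  prunedChildren-≢[] (w , t) es = select-≢[] (w , prune t) (pruneEdges es)

  prunedChildren-star : ∀ es {w ds} → (w , node ⋇ ds) ∈ prunedChildren es →
    prunedChildren es ≡ (w , node ⋇ ds) ∷ []
  prunedChildren-star es = select-rejected (pruneEdges es) λ ()

  label-prune : ∀ t → label W (prune t) ≡ label W t
  label-prune (node ⋇ _) = refl
  label-prune (node (cl _) _) = refl

  prune-leaf : ∀ t {L} → prune t ≡ node (cl L) [] → t ≡ node (cl L) []
  prune-leaf (node ⋇ _) ()
  prune-leaf (node (cl _) []) refl = refl
  prune-leaf (node (cl _) (e ∷ es)) p = ⊥-elim (prunedChildren-≢[] e es (cong (children W) p))

  prune-subtree : ∀ t {s} → SubTree W s (prune t) → ∃[ s₀ ] (SubTree W s₀ t × s ≡ prune s₀)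
  prune-subtree t@(node ⋇ _) here = t , here , refl
  prune-subtree (node ⋇ _) (there () _)
  prune-subtree t@(node (cl _) _) here = t , here , refl
  prune-subtree (node (cl _) es) (there m sub) with prunedChild-origin es m
  ... | t , m′ , refl with prune-subtree t sub
  ... | s₀ , sub′ , e = s₀ , there m′ sub′ , e

  pruneForest-node : ∀ F {s} → NodeOf W s (pruneForest F) → ∃[ s₀ ] (NodeOf W s₀ F × s ≡ prune s₀)
  pruneForest-node F (_ , m , sub) with ∈-map⁻ prune m
  ... | t , m′ , refl with prune-subtree t sub
  ... | s₀ , sub′ , e = s₀ , (t , m′ , sub′) , e

  data SameLength {t u : Tree W} (b : Branch W t) (b′ : Branch W u) : Set where
    both-starred : containsStar W b → containsStar W b′ → SameLength b b′
    both-proper  : ¬ containsStar W b → ¬ containsStar W b′ →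
                   weightSum W b ≡ weightSum W b′ → SameLength b b′

  sameLength-step : ∀ {L L′ es es′ w t t′} {m : (w , t) ∈ es} {m′ : (w , t′) ∈ es′}
    {b : Branch W t} {b′ : Branch W t′} → SameLength b b′ →
    SameLength (step {l = cl L} m b) (step {l = cl L′} m′ b′)
  sameLength-step (both-starred p q) = both-starred p q
  sameLength-step {w = w} (both-proper np nq e) = both-proper np nq (cong (w +_) e)

  branchLength-transfer : ∀ {t u} {b : Branch W t} {b′ : Branch W u} {x} →
    SameLength b b′ → BranchLength W b′ x → BranchLength W b x
  branchLength-transfer (both-starred p _) (starred _) = starred p
  branchLength-transfer (both-starred _ q) (proper nq) = ⊥-elim (nq q)
  branchLength-transfer (both-proper _ nq _) (starred q) = ⊥-elim (nq q)
  branchLength-transfer {b = b} (both-proper np _ e) (proper _) =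
    subst (BranchLength W b) e (proper np)

  -- every tree has a branch (needed above a ⋇-node whose children were cut)
  someBranch : ∀ t → Branch W t
  someBranch (node _ []) = leaf
  someBranch (node _ ((_ , t) ∷ _)) = step (here refl) (someBranch t)

  mutual
    prune-branch : ∀ t (b′ : Branch W (prune t)) → Σ (Branch W t) λ b → SameLength b b′
    prune-branch (node ⋇ _) leaf = someBranch _ , both-starred tt tt
    prune-branch (node ⋇ _) (step () _)
    prune-branch (node (cl _) []) leaf = leaf , both-proper (λ ()) (λ ()) refl
    prune-branch (node (cl _) []) (step () _)
    prune-branch (node (cl _) (e ∷ es)) b′ = prune-branch-below refl b′

    prune-branch-below : ∀ {L e es ps} → ps ≡ prunedChildren (e ∷ es) →
      (b′ : Branch W (node (cl L) ps)) → Σ (Branch W (node (cl L) (e ∷ es))) λ b → SameLength b b′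
    prune-branch-below {e = e} {es} eq leaf = ⊥-elim (prunedChildren-≢[] e es (sym eq))
    prune-branch-below {e = e} {es} refl (step m b′) with prunedChild-origin (e ∷ es) m
    ... | t , m₀ , refl with prune-branch t b′
    ... | b , same = step m₀ b , sameLength-step same

  pruneForest-root : ∀ {F K} → ∃[ t ] ∃[ L ] (t ∈ F × label W t ≡ cl L × L ⊆ K) →
    ∃[ t ] ∃[ L ] (t ∈ pruneForest F × label W t ≡ cl L × L ⊆ K)
  pruneForest-root (t , L , t∈ , lab , L⊆K) =
    prune t , L , ∈-map⁺ prune t∈ , trans (label-prune t) lab , L⊆K

  pruneForest-leaf : ∀ F {L} → NodeOf W (node (cl L) []) (pruneForest F) → NodeOf W (node (cl L) []) F
  pruneForest-leaf F nd with pruneForest-node F nd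
  ... | s₀ , nd₀ , e = subst (λ s → NodeOf W s F) (prune-leaf s₀ (sym e)) nd₀

  pruneForest-length : ∀ F {r} → LengthAtMost W F r → LengthAtMost W (pruneForest F) r
  pruneForest-length F bounded m b′ len with ∈-map⁻ prune m
  ... | t , m₀ , refl with prune-branch t b′
  ... | b , same = bounded m₀ b (branchLength-transfer same len)

  module _ (T : BasicTheory W) where

    Justification : Clause → List Edge → Set
    Justification L es = ∃[ c ] (AllWeights W es c ×
      (RuleA W T L es c ⊎ RuleB W T L es c ⊎ RuleC W L es c ⊎ RuleD W L es c))

    covered-prune : ∀ {es K} → ∃[ L′ ] (ChildClause W es L′ × L′ ⊆ K) →
      ∃[ L′ ] (ChildClause W (prunedChildren es) L′ × L′ ⊆ K)
    covered-prune {es} (L′ , (w , ds , m) , L′⊆K) =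
      L′ , (w , prunedChildren ds , prunedChild-clause es m) , L′⊆K

    ruleA-prune : ∀ {L es c} → RuleA W T L es c → RuleA W T L (prunedChildren es) c
    ruleA-prune (c≡0 , bi , bi∈T , grade , prem , covered) =
      c≡0 , bi , bi∈T , grade , prem , λ M∈ → covered-prune (covered M∈)

    ruleB-prune : ∀ {L es c} → RuleB W T L es c → RuleB W T L (prunedChildren es) c
    ruleB-prune (0<c , bi , bi∈T , grade , prem , covered) =
      0<c , bi , bi∈T , grade , prem , λ M∈ → covered-prune (covered M∈)

    ruleC-prune : ∀ {L es c} → RuleC W L es c → RuleC W L (prunedChildren es) c
    ruleC-prune (c≡0 , inconsistent , w , _ , refl) = c≡0 , inconsistent , w , [] , refl

    ruleD-prune : ∀ {L es c} → RuleD W L es c → RuleD W L (prunedChildren es) c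
    ruleD-prune (c≡0 , φ , w₁ , L₁ , ds₁ , w₂ , L₂ , ds₂ , refl , splits) =
      c≡0 , φ , w₁ , L₁ , prunedChildren ds₁ , w₂ , L₂ , prunedChildren ds₂ , refl , splits

    justification-prune : ∀ {L} es → Justification L es → Justification L (prunedChildren es)
    justification-prune es (c , weights , rule) =
      c , (λ m → weights (proj₁ (proj₂ (prunedChild-origin es m)))) ,
      ⊎-map ruleA-prune (⊎-map ruleB-prune (⊎-map ruleC-prune ruleD-prune)) rule

    T4Node-clause : ∀ {L} es → es ≢ [] → Justification L es → T4Node W T (node (cl L) es)
    T4Node-clause [] es≢[] _ = ⊥-elim (es≢[] refl)
    T4Node-clause (_ ∷ _) _ justified = justified

    prune-T4 : ∀ s → T4Node W T s → T4Node W T (prune s)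
    prune-T4 (node ⋇ _) _ = tt
    prune-T4 (node (cl _) []) _ = tt
    prune-T4 (node (cl _) (e ∷ es)) justified =
      T4Node-clause (prunedChildren (e ∷ es)) (prunedChildren-≢[] e es)
        (justification-prune (e ∷ es) justified)

    pruneForest-T4 : ∀ F → (∀ {s} → NodeOf W s F → T4Node W T s) →
      ∀ {s} → NodeOf W s (pruneForest F) → T4Node W T s
    pruneForest-T4 F steps nd with pruneForest-node F nd
    ... | s₀ , nd₀ , refl = prune-T4 s₀ (steps nd₀)

    pruneForest-proof : ∀ {ζ r η F} → ForestProof W T ζ r η F → ForestProof W T ζ r η (pruneForest F)
    pruneForest-proof {F = F} record { T1 = B₁ , B₁-ζ , roots ; T2 = B₂ , B₂-η , leaves
                                     ; T3 = bounded ; T4 = steps } = record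
      { T1 = B₁ , B₁-ζ , λ K∈ → pruneForest-root (roots K∈)
      ; T2 = B₂ , B₂-η , λ nd → leaves (pruneForest-leaf F nd)
      ; T3 = pruneForest-length F bounded
      ; T4 = pruneForest-T4 F steps
      }

  pruneForest-starsTerminal : ∀ F → StarsTerminal W (pruneForest F)
  pruneForest-starsTerminal F nd with pruneForest-node F nd
  ... | node ⋇ _ , _ , refl = refl
  ... | node (cl _) _ , _ , ()

  pruneForest-noStarSiblings : ∀ F → StarsNoSiblings W (pruneForest F)
  pruneForest-noStarSiblings F nd star∈ with pruneForest-node F nd
  pruneForest-noStarSiblings F nd () | node ⋇ _ , _ , refl
  ... | node (cl _) es , _ , refl = _ , _ , prunedChildren-star es star∈

lemma3p6 : (W : Weights) (T : BasicTheory W) (ζ η : Formula) (r : Weights.Carrier W) →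
    (∃[ F ] ForestProof W T ζ r η F) →
    ∃[ F' ] (ForestProof W T ζ r η F' × StarsTerminal W F' × StarsNoSiblings W F')
lemma3p6 W T ζ η r (F , proof) =
  pruneForest F , pruneForest-proof T proof , pruneForest-starsTerminal F , pruneForest-noStarSiblings F
  where open Pruning W
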